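{- There exists a universal constant $c>0$ such that for any $n,k,d\in\mathbb{N}$ the following holds. Let $\mathbf{X}\sim\{0,1\}^n$ be a $d$-local source with min-entropy $\geq k$. Then there is a $d$-local NOBF source $\mathbf{X}'\sim\{0,1\}^n$ with min-entropy $\geq k'$ such that $\mathrm{support}(\mathbf{X}')\subseteq\mathrm{support}(\mathbf{X})$, where $k'=\frac{ck}{d^2}$.
   Context: A random variable $\mathbf{X}\sim\{0,1\}^n$ is a $d$-local source if $\mathbf{X}=g(\mathbf{U}_\ell)$ for some $\ell$ and some $g:\{0,1\}^\ell\to\{0,1\}^n$ each of whose output bits depends on at most $d$ input bits, with $\mathbf{U}_\ell$ uniform. Min-entropy is $H_\infty(\mathbf{X})=-\log_2\max_x\Pr[\mathbf{X}=x]$. A $d$-local NOBF source with min-entropy $m$ is a random variable $\mathbf{X}\sim\{0,1\}^n$ for which there is $S\subseteq[n]$ with $|S|=m$ such that $\mathbf{X}_S$ is uniform on $\{0,1\}^m$ and every bit $\mathbf{X}_j$, $j\notin S$, is a deterministic function of at most $d$ bits of $\mathbf{X}_S$. -}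

module Defs where

open import Data.Nat using (ℕ; zero; suc; _+_; _*_; _^_; _≤_; _<_)
open import Data.Bool using (Bool; true; false) renaming (_≟_ to _≟ᵇ_)
open import Data.Fin using (Fin)
open import Data.Fin.Subset using (Subset; _∈_; ∣_∣)
open import Data.Vec using (Vec; []; _∷_; lookup; tabulate)
open import Data.Vec.Properties using (≡-dec)
open import Data.List using (List; [_]; _++_; map; filter; length)
open import Data.Product using (Σ; ∃; ∃-syntax; _×_)
open import Relation.Binary.PropositionalEquality using (_≡_)
open import Relation.Nullary using (¬_)
open import Function.Definitions using (Injective)

Bits : ℕ → Set
Bits n = Vec Bool n

allBits : (ℓ : ℕ) → List (Bits ℓ)
allBits zero    = [ [] ]
allBits (suc ℓ) = map (true ∷_) (allBits ℓ) ++ map (false ∷_) (allBits ℓ)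

-- A random variable over {0,1}^n given as  g(U_ℓ)  with U_ℓ uniform.
-- #preimages of x under g  (so  Pr[g(U_ℓ) = x] = count g x / 2^ℓ )
count : ∀ {ℓ n} → (Bits ℓ → Bits n) → Bits n → ℕ
count {ℓ} g x = length (filter (λ u → ≡-dec _≟ᵇ_ (g u) x) (allBits ℓ))

-- H_∞(g(U_ℓ)) ≥ k  ⇔  ∀ x, Pr[g(U_ℓ)=x] ≤ 2^{-k}
MinEntropyAtLeast : ∀ {ℓ n} → ℕ → (Bits ℓ → Bits n) → Set
MinEntropyAtLeast {ℓ} k g = ∀ x → count g x * 2 ^ k ≤ 2 ^ ℓ

DependsOnly : ∀ {ℓ n} → (Bits ℓ → Bits n) → Fin n → Subset ℓ → Set
DependsOnly {ℓ} g i T =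
  ∀ (u v : Bits ℓ) → (∀ j → j ∈ T → lookup u j ≡ lookup v j) → lookup (g u) i ≡ lookup (g v) i

Local : ∀ {ℓ n} → ℕ → (Bits ℓ → Bits n) → Set
Local {ℓ} {n} d g = ∀ (i : Fin n) → ∃[ T ] (∣ T ∣ ≤ d × DependsOnly g i T)

restrict : ∀ {m n} → (Fin m → Fin n) → Bits n → Bits m
restrict σ x = tabulate (λ t → lookup x (σ t))

-- The random variable X = h(U_ℓ) is a d-local NOBF source with min-entropy m:
-- there is a set S ⊆ [n] with |S| = m (given as the image of an injection
-- σ : Fin m → Fin n) such that X_S is uniform on {0,1}^m and every bit X_j,
-- j ∉ S, is a deterministic function of at most d bits of X_S.
NOBF : ∀ {ℓ n} → ℕ → ℕ → (Bits ℓ → Bits n) → Set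
NOBF {ℓ} {n} d m h =
  Σ (Fin m → Fin n) λ σ →
    Injective _≡_ _≡_ σ
    × (∀ (y : Bits m) → count (λ u → restrict σ (h u)) y * 2 ^ m ≡ 2 ^ ℓ)
    × (∀ (j : Fin n) → ¬ (∃[ t ] (σ t ≡ j)) →
         ∃[ T ] (∣ T ∣ ≤ d ×
           (∀ (u v : Bits ℓ) →
              (∀ t → t ∈ T → lookup (restrict σ (h u)) t ≡ lookup (restrict σ (h v)) t) →
              lookup (h u) j ≡ lookup (h v) j)))

SupportSubset : ∀ {ℓ' ℓ n} → (Bits ℓ' → Bits n) → (Bits ℓ → Bits n) → Set
SupportSubset h g = ∀ u' → ∃[ u ] (g u ≡ h u')

{-# OPTIONS --safe #-}
module Submission where

-- Induction on the locality d.  Greedily pick output bits i₁, …, i_r whose input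
-- supports are pairwise disjoint, each together with an input position p_t and a
-- point w_t at which flipping p_t flips bit i_t, until every non-constant output bit
-- has a support meeting the union U of the chosen supports.  If k ≤ d²r, freeze each
-- chosen support at w_t except for the free position p_t: bit i_t then reads off the
-- t-th free bit bijectively, and any other output bit j only sees the free positions
-- inside its own support, at most d of them, so this is a d-local NOBF source on r
-- bits.  Otherwise set U to 0: this costs at most |U| ≤ dr ≤ k/d bits of min-entropy
-- and removes an input from the support of every non-constant output bit, so the
-- (d-1)-local case applies, and (d-1)²m ≥ k - k/d gives k ≤ d²m.

open import Defs
open import Data.Bool using (Bool; true; false; if_then_else_) renaming (_≟_ to _≟ᵇ_)
open import Data.Bool.Properties using (¬-not)
open import Data.Empty using (⊥-elim)
open import Data.Fin using (Fin; zero; suc)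
open import Data.Fin.Properties using (all?; ¬∀⟶∃¬) renaming (_≟_ to _≟ᶠ_)
open import Data.Fin.Subset using (Subset; _∈_; _∉_; ∣_∣; _∪_; _∩_; _─_; ⊥; _⊆_; Nonempty; Empty)
open import Data.Fin.Subset.Properties
  using (_∈?_; nonempty?; ∉⊥; ∣⊥∣≡0; p⊆p∪q; q⊆p∪q; x∈p∩q⁺; x∈p∩q⁻; x∈p∧x∉q⇒x∈p─q;
         p⊂q⇒∣p∣<∣q∣; p⊆q⇒∣p∣≤∣q∣; ∣p∩q∣≤∣p∣; ∣p─q∣≤∣p∣; p∩q≢∅⇒∣p─q∣<∣p∣; x∈p⇒∣p-x∣<∣p∣)
open import Data.List using (List; []; _∷_; _++_; map; filter; length; allFin)
import Data.List as List
open import Data.List.Properties using (filter-++; filter-≐; filter-all; filter-none; length-++; length-map)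
open import Data.List.Relation.Unary.All as All using (All; []; _∷_)
open import Data.List.Membership.Propositional.Properties using (∈-allFin)
open import Data.Nat using (ℕ; zero; suc; _+_; _*_; _^_; _∸_; _≤_; _<_; z≤n; s≤s; z<s; _≤?_)
open import Data.Nat.Properties
open import Data.Nat.Tactic.RingSolver using (solve-∀)
open import Data.Product using (Σ; ∃; ∃₂; ∃-syntax; _×_; _,_; proj₁; proj₂)
open import Data.Sum using (_⊎_; inj₁; inj₂)
open import Data.Unit using (⊤; tt)
open import Data.Vec using (Vec; []; _∷_; here; there; lookup; tabulate; replicate; _[_]≔_)
open import Data.Vec.Properties
  using (≡-dec; ∷-injectiveˡ; ∷-injectiveʳ; lookup∘tabulate; tabulate∘lookup; tabulate-cong; lookup∘update′)
open import Function using (_∘_; id)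
open import Function.Definitions using (Injective)
open import Relation.Binary.PropositionalEquality
open import Relation.Nullary using (¬_; Dec; yes; no; does; contradiction)

lookup-ext : ∀ {A : Set} {m} (u v : Vec A m) → (∀ t → lookup u t ≡ lookup v t) → u ≡ v
lookup-ext u v eq = trans (sym (tabulate∘lookup u)) (trans (tabulate-cong eq) (tabulate∘lookup v))

bool-injective : ∀ (F : Bool → Bool) → F true ≢ F false → ∀ {a b} → F a ≡ F b → a ≡ b
bool-injective F F-inj {true}  {true}  _ = refl
bool-injective F F-inj {false} {false} _ = refl
bool-injective F F-inj {true}  {false} e = ⊥-elim (F-inj e)
bool-injective F F-inj {false} {true}  e = ⊥-elim (F-inj (sym e))

bool-surjective : ∀ (F : Bool → Bool) → F true ≢ F false → ∀ z → ∃[ b ] F b ≡ z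
bool-surjective F F-inj z with F true ≟ᵇ z
... | yes eq = true , eq
... | no  ne = false , trans (¬-not (F-inj ∘ sym)) (sym (¬-not (ne ∘ sym)))

∣p∪q∣≤∣p∣+∣q∣ : ∀ {m} (p q : Subset m) → ∣ p ∪ q ∣ ≤ ∣ p ∣ + ∣ q ∣
∣p∪q∣≤∣p∣+∣q∣ []          []          = z≤n
∣p∪q∣≤∣p∣+∣q∣ (true ∷ p)  (true ∷ q)  = s≤s (≤-trans (m≤n⇒m≤1+n (∣p∪q∣≤∣p∣+∣q∣ p q)) (≤-reflexive (sym (+-suc _ _))))
∣p∪q∣≤∣p∣+∣q∣ (true ∷ p)  (false ∷ q) = s≤s (∣p∪q∣≤∣p∣+∣q∣ p q)
∣p∪q∣≤∣p∣+∣q∣ (false ∷ p) (true ∷ q)  = ≤-trans (s≤s (∣p∪q∣≤∣p∣+∣q∣ p q)) (≤-reflexive (sym (+-suc _ _)))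
∣p∪q∣≤∣p∣+∣q∣ (false ∷ p) (false ∷ q) = ∣p∪q∣≤∣p∣+∣q∣ p q

2^k≤1⇒k≡0 : ∀ k → 2 ^ k ≤ 1 → k ≡ 0
2^k≤1⇒k≡0 zero    _  = refl
2^k≤1⇒k≡0 (suc k) le = contradiction le (<⇒≱ (^-monoʳ-< 2 (s≤s (s≤s z≤n)) (z<s {k})))

filter-map : ∀ {A B : Set} {P : B → Set} (P? : ∀ b → Dec (P b)) (f : A → B) (xs : List A) →
             filter P? (map f xs) ≡ map f (filter (P? ∘ f) xs)
filter-map P? f []       = refl
filter-map P? f (x ∷ xs) with does (P? (f x))
... | true  = cong (f x ∷_) (filter-map P? f xs)
... | false = filter-map P? f xs

length-allBits : ∀ ℓ → length (allBits ℓ) ≡ 2 ^ ℓ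
length-allBits zero    = refl
length-allBits (suc ℓ) = begin
  length (map (true ∷_) us ++ map (false ∷_) us)           ≡⟨ length-++ (map (true ∷_) us) ⟩
  length (map (true ∷_) us) + length (map (false ∷_) us)   ≡⟨ cong₂ _+_ (length-map _ us) (length-map _ us) ⟩
  length us + length us                                     ≡⟨ cong₂ _+_ (length-allBits ℓ) (length-allBits ℓ) ⟩
  2 ^ ℓ + 2 ^ ℓ                                             ≡⟨ cong (2 ^ ℓ +_) (sym (+-identityʳ (2 ^ ℓ))) ⟩
  2 ^ suc ℓ                                                 ∎
  where
  open ≡-Reasoning
  us = allBits ℓ

count-cong : ∀ {ℓ n n′} (f : Bits ℓ → Bits n) (f′ : Bits ℓ → Bits n′) x x′ →
             (∀ {u} → f u ≡ x → f′ u ≡ x′) → (∀ {u} → f′ u ≡ x′ → f u ≡ x) →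
             count f x ≡ count f′ x′
count-cong {ℓ} f f′ x x′ to from = cong length (filter-≐ _ _ (to , from) (allBits ℓ))

count-none : ∀ {ℓ n} (f : Bits ℓ → Bits n) x → (∀ u → f u ≢ x) → count f x ≡ 0
count-none {ℓ} f x ne = cong length (filter-none _ (All.universal ne (allBits ℓ)))

count-all : ∀ {ℓ n} (f : Bits ℓ → Bits n) x → (∀ u → f u ≡ x) → count f x ≡ 2 ^ ℓ
count-all {ℓ} f x eq = trans (cong length (filter-all _ (All.universal eq (allBits ℓ)))) (length-allBits ℓ)

count-suc : ∀ {ℓ n} (f : Bits (suc ℓ) → Bits n) x →
            count f x ≡ count (f ∘ (true ∷_)) x + count (f ∘ (false ∷_)) x
count-suc {ℓ} f x = begin
  length (filter P? (map (true ∷_) us ++ map (false ∷_) us))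
    ≡⟨ cong length (filter-++ P? (map (true ∷_) us) (map (false ∷_) us)) ⟩
  length (filter P? (map (true ∷_) us) ++ filter P? (map (false ∷_) us))
    ≡⟨ length-++ (filter P? (map (true ∷_) us)) ⟩
  length (filter P? (map (true ∷_) us)) + length (filter P? (map (false ∷_) us))
    ≡⟨ cong₂ _+_ (length-filter-cons true) (length-filter-cons false) ⟩
  count (f ∘ (true ∷_)) x + count (f ∘ (false ∷_)) x
    ∎
  where
  open ≡-Reasoning
  us = allBits ℓ
  P? = λ u → ≡-dec _≟ᵇ_ (f u) x
  length-filter-cons : ∀ b → length (filter P? (map (b ∷_) us)) ≡ count (f ∘ (b ∷_)) x
  length-filter-cons b = trans (cong length (filter-map P? (b ∷_) us)) (length-map (b ∷_) (filter (P? ∘ (b ∷_)) us))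

count-∷ : ∀ {ℓ} b (y : Bits ℓ) → count (b ∷_) (b ∷ y) ≡ count id y
count-∷ b y = count-cong (b ∷_) id (b ∷ y) y ∷-injectiveʳ (cong (b ∷_))

count-∷-≢ : ∀ {ℓ} {b c} (y : Bits ℓ) → b ≢ c → count (b ∷_) (c ∷ y) ≡ 0
count-∷-≢ {b = b} {c} y b≢c = count-none (b ∷_) (c ∷ y) (λ u e → b≢c (∷-injectiveˡ e))

count-id : ∀ {ℓ} (y : Bits ℓ) → count id y ≡ 1
count-id []          = refl
count-id (true ∷ y)  = trans (count-suc id (true ∷ y))
  (cong₂ _+_ (trans (count-∷ true y) (count-id y)) (count-∷-≢ y λ ()))
count-id (false ∷ y) = trans (count-suc id (false ∷ y))
  (cong₂ _+_ (count-∷-≢ y λ ()) (trans (count-∷ false y) (count-id y)))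

count-unique : ∀ {ℓ n} (f : Bits ℓ → Bits n) x u₀ → f u₀ ≡ x → (∀ {u} → f u ≡ x → u ≡ u₀) → count f x ≡ 1
count-unique f x u₀ fu₀≡x unique = trans (count-cong f id x u₀ unique (λ { refl → fu₀≡x })) (count-id u₀)

count-bitwise-bijection : ∀ {m} (f : Bits m → Bits m) (F : Fin m → Bool → Bool) →
  (∀ t → F t true ≢ F t false) → (∀ u t → lookup (f u) t ≡ F t (lookup u t)) → ∀ z → count f z ≡ 1
count-bitwise-bijection f F F-inj f≡F z =
  count-unique f z u₀ (lookup-ext _ _ fu₀≈z) (λ fu≡z → lookup-ext _ _ (unique fu≡z))
  where
  open ≡-Reasoning
  preimage : ∀ t → ∃[ b ] F t b ≡ lookup z t
  preimage t = bool-surjective (F t) (F-inj t) (lookup z t)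
  u₀ = tabulate (proj₁ ∘ preimage)
  fu₀≈z : ∀ t → lookup (f u₀) t ≡ lookup z t
  fu₀≈z t = begin
    lookup (f u₀) t           ≡⟨ f≡F u₀ t ⟩
    F t (lookup u₀ t)         ≡⟨ cong (F t) (lookup∘tabulate _ t) ⟩
    F t (proj₁ (preimage t))  ≡⟨ proj₂ (preimage t) ⟩
    lookup z t                ∎
  unique : ∀ {u} → f u ≡ z → ∀ t → lookup u t ≡ lookup u₀ t
  unique {u} fu≡z t = bool-injective (F t) (F-inj t) (begin
    F t (lookup u t)   ≡⟨ f≡F u t ⟨
    lookup (f u) t     ≡⟨ cong (λ v → lookup v t) fu≡z ⟩
    lookup z t         ≡⟨ fu₀≈z t ⟨
    lookup (f u₀) t    ≡⟨ f≡F u₀ t ⟩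
    F t (lookup u₀ t)  ∎)

-- Fixing input coordinates

override : ∀ {ℓ} → Subset ℓ → Bits ℓ → Bits ℓ → Bits ℓ
override []      []       []       = []
override (s ∷ T) (a ∷ as) (v ∷ vs) = (if s then a else v) ∷ override T as vs

lookup-override-∈ : ∀ {ℓ} (T : Subset ℓ) a v {c} → c ∈ T → lookup (override T a v) c ≡ lookup a c
lookup-override-∈ (true ∷ T) (a ∷ as) (v ∷ vs) {zero}  here      = refl
lookup-override-∈ (s ∷ T)    (a ∷ as) (v ∷ vs) {suc c} (there x) = lookup-override-∈ T as vs x

lookup-override-∉ : ∀ {ℓ} (T : Subset ℓ) a v {c} → c ∉ T → lookup (override T a v) c ≡ lookup v c
lookup-override-∉ (true ∷ T)  (a ∷ as) (v ∷ vs) {zero}  c∉T = contradiction here c∉T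
lookup-override-∉ (false ∷ T) (a ∷ as) (v ∷ vs) {zero}  c∉T = refl
lookup-override-∉ (s ∷ T)     (a ∷ as) (v ∷ vs) {suc c} c∉T = lookup-override-∉ T as vs (c∉T ∘ there)

clear : ∀ {ℓ} → Subset ℓ → Bits ℓ → Bits ℓ
clear U = override U (replicate _ false)

count-clear : ∀ {ℓ n} (U : Subset ℓ) (f : Bits ℓ → Bits n) x → count (f ∘ clear U) x ≤ 2 ^ ∣ U ∣ * count f x
count-clear [] f x = ≤-reflexive (trans (count-cong (f ∘ clear []) f x x (λ { {[]} e → e }) (λ { {[]} e → e }))
                                        (sym (+-identityʳ (count f x))))
count-clear (true ∷ U) f x = begin
  count (f ∘ clear (true ∷ U)) x                     ≡⟨ count-suc (f ∘ clear (true ∷ U)) x ⟩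
  count (f₀ ∘ clear U) x + count (f₀ ∘ clear U) x   ≤⟨ +-mono-≤ (count-clear U f₀ x) (count-clear U f₀ x) ⟩
  2 ^ ∣ U ∣ * c₀ + 2 ^ ∣ U ∣ * c₀                     ≡⟨ cong (2 ^ ∣ U ∣ * c₀ +_) (sym (+-identityʳ _)) ⟩
  2 * (2 ^ ∣ U ∣ * c₀)                                ≡⟨ *-assoc 2 (2 ^ ∣ U ∣) c₀ ⟨
  2 ^ suc ∣ U ∣ * c₀                                  ≤⟨ *-monoʳ-≤ (2 ^ suc ∣ U ∣) (m≤n+m c₀ c₁) ⟩
  2 ^ suc ∣ U ∣ * (c₁ + c₀)                           ≡⟨ cong (2 ^ suc ∣ U ∣ *_) (count-suc f x) ⟨
  2 ^ suc ∣ U ∣ * count f x                           ∎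
  where
  open ≤-Reasoning
  f₀ = f ∘ (false ∷_)
  c₀ = count f₀ x
  c₁ = count (f ∘ (true ∷_)) x
count-clear (false ∷ U) f x = begin
  count (f ∘ clear (false ∷ U)) x                               ≡⟨ count-suc (f ∘ clear (false ∷ U)) x ⟩
  count (f ∘ (true ∷_) ∘ clear U) x + count (f ∘ (false ∷_) ∘ clear U) x
    ≤⟨ +-mono-≤ (count-clear U (f ∘ (true ∷_)) x) (count-clear U (f ∘ (false ∷_)) x) ⟩
  2 ^ ∣ U ∣ * c₁ + 2 ^ ∣ U ∣ * c₀                                ≡⟨ *-distribˡ-+ (2 ^ ∣ U ∣) c₁ c₀ ⟨
  2 ^ ∣ U ∣ * (c₁ + c₀)                                          ≡⟨ cong (2 ^ ∣ U ∣ *_) (count-suc f x) ⟨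
  2 ^ ∣ U ∣ * count f x                                          ∎
  where
  open ≤-Reasoning
  c₀ = count (f ∘ (false ∷_)) x
  c₁ = count (f ∘ (true ∷_)) x

minEntropy-clear : ∀ {ℓ n k} (U : Subset ℓ) (g : Bits ℓ → Bits n) → ∣ U ∣ ≤ k →
                   MinEntropyAtLeast k g → MinEntropyAtLeast (k ∸ ∣ U ∣) (g ∘ clear U)
minEntropy-clear {ℓ} {k = k} U g ∣U∣≤k me x = begin
  count (g ∘ clear U) x * 2 ^ (k ∸ s)     ≤⟨ *-monoˡ-≤ (2 ^ (k ∸ s)) (count-clear U g x) ⟩
  2 ^ s * count g x * 2 ^ (k ∸ s)         ≡⟨ cong (_* 2 ^ (k ∸ s)) (*-comm (2 ^ s) (count g x)) ⟩
  count g x * 2 ^ s * 2 ^ (k ∸ s)         ≡⟨ *-assoc (count g x) (2 ^ s) _ ⟩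
  count g x * (2 ^ s * 2 ^ (k ∸ s))       ≡⟨ cong (count g x *_) (^-distribˡ-+-* 2 s (k ∸ s)) ⟨
  count g x * 2 ^ (s + (k ∸ s))           ≡⟨ cong (λ e → count g x * 2 ^ e) (m+[n∸m]≡n ∣U∣≤k) ⟩
  count g x * 2 ^ k                       ≤⟨ me x ⟩
  2 ^ ℓ                                   ∎
  where
  open ≤-Reasoning
  s = ∣ U ∣

dependsOnly-clear : ∀ {ℓ n} (U : Subset ℓ) (g : Bits ℓ → Bits n) {i T} →
                    DependsOnly g i T → DependsOnly (g ∘ clear U) i (T ─ U)
dependsOnly-clear U g {T = T} dep u v agree = dep (clear U u) (clear U v) λ c c∈T → agreeAt c∈T (c ∈? U)
  where
  agreeAt : ∀ {c} → c ∈ T → Dec (c ∈ U) → lookup (clear U u) c ≡ lookup (clear U v) c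
  agreeAt _   (yes c∈U) = trans (lookup-override-∈ U _ u c∈U) (sym (lookup-override-∈ U _ v c∈U))
  agreeAt {c} c∈T (no c∉U) = begin
    lookup (clear U u) c  ≡⟨ lookup-override-∉ U _ u c∉U ⟩
    lookup u c            ≡⟨ agree c (x∈p∧x∉q⇒x∈p─q c∈T c∉U) ⟩
    lookup v c            ≡⟨ lookup-override-∉ U _ v c∉U ⟨
    lookup (clear U v) c  ∎
    where open ≡-Reasoning

Unflipped : ∀ {ℓ n} → (Bits ℓ → Bits n) → Fin n → Bits ℓ → Fin ℓ → Set
Unflipped g i w p = lookup (g (w [ p ]≔ true)) i ≡ lookup (g (w [ p ]≔ false)) i

unflipped? : ∀ {ℓ n} (g : Bits ℓ → Bits n) i w p → Dec (Unflipped g i w p)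
unflipped? g i w p = lookup (g (w [ p ]≔ true)) i ≟ᵇ lookup (g (w [ p ]≔ false)) i

FlipInvariant : ∀ {ℓ n} → (Bits ℓ → Bits n) → Fin n → Set
FlipInvariant g i = ∀ w p → Unflipped g i w p

SensitiveAt : ∀ {ℓ n} → (Bits ℓ → Bits n) → Fin n → Bits ℓ → Fin ℓ → Set
SensitiveAt g i w p = ¬ Unflipped g i w p

flipInvariant⇒dependsOnly-⊥ : ∀ {ℓ n} (g : Bits ℓ → Bits n) i → FlipInvariant g i → DependsOnly g i ⊥
flipInvariant⇒dependsOnly-⊥ g i inv []      []      _ = refl
flipInvariant⇒dependsOnly-⊥ g i inv (a ∷ u) (b ∷ v) _ =
  trans (flip-head a b)
        (flipInvariant⇒dependsOnly-⊥ (g ∘ (b ∷_)) i (λ w p → inv (b ∷ w) (suc p)) u v (λ _ c∈⊥ → contradiction c∈⊥ ∉⊥))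
  where
  flip-head : ∀ a b → lookup (g (a ∷ u)) i ≡ lookup (g (b ∷ u)) i
  flip-head true  true  = refl
  flip-head false false = refl
  flip-head true  false = inv (a ∷ u) zero
  flip-head false true  = sym (inv (a ∷ u) zero)

universal-or-counterexample : ∀ {ℓ} {P : Bits ℓ → Set} → (∀ w → Dec (P w)) → (∀ w → P w) ⊎ ∃[ w ] ¬ P w
universal-or-counterexample {zero} P? with P? []
... | yes p  = inj₁ λ { [] → p }
... | no  ¬p = inj₂ ([] , ¬p)
universal-or-counterexample {suc ℓ} P?
  with universal-or-counterexample (P? ∘ (true ∷_)) | universal-or-counterexample (P? ∘ (false ∷_))
... | inj₂ (w , ¬p) | _             = inj₂ (true ∷ w , ¬p)
... | inj₁ _        | inj₂ (w , ¬p) = inj₂ (false ∷ w , ¬p)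
... | inj₁ all₁     | inj₁ all₀     = inj₁ λ { (true ∷ w) → all₁ w ; (false ∷ w) → all₀ w }

flipInvariant-or-sensitive : ∀ {ℓ n} (g : Bits ℓ → Bits n) i → FlipInvariant g i ⊎ ∃₂ (SensitiveAt g i)
flipInvariant-or-sensitive {ℓ} g i with universal-or-counterexample (λ w → all? (unflipped? g i w))
... | inj₁ inv        = inj₁ inv
... | inj₂ (w , ¬inv) = inj₂ (w , ¬∀⟶∃¬ ℓ _ (unflipped? g i w) ¬inv)

sensitive⇒∈ : ∀ {ℓ n} {g : Bits ℓ → Bits n} {i w p T} → DependsOnly g i T → SensitiveAt g i w p → p ∈ T
sensitive⇒∈ {w = w} {p} {T} dep sens with p ∈? T
... | yes p∈T = p∈T
... | no  p∉T = contradiction (dep _ _ unflipped) sens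
  where
  unflipped : ∀ c → c ∈ T → lookup (w [ p ]≔ true) c ≡ lookup (w [ p ]≔ false) c
  unflipped c c∈T = trans (lookup∘update′ c≢p w true) (sym (lookup∘update′ c≢p w false))
    where
    c≢p : c ≢ p
    c≢p c≡p = p∉T (subst (_∈ T) c≡p c∈T)

NOBFSubsource : ∀ {ℓ n} → ℕ → ℕ → (Bits ℓ → Bits n) → Set
NOBFSubsource {n = n} d k g =
  ∃[ ℓ′ ] Σ (Bits ℓ′ → Bits n) λ h → ∃[ m ] (NOBF d m h × k ≤ d * d * m × SupportSubset h g)

-- Families of sensitive output bits with disjoint supports

module Family {ℓ n} (g : Bits ℓ → Bits n) (supp : Fin n → Subset ℓ) (dep : ∀ i → DependsOnly g i (supp i)) where

  record Witness : Set where
    constructor witness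
    field
      out       : Fin n
      base      : Bits ℓ
      pos       : Fin ℓ
      sensitive : SensitiveAt g out base pos
  open Witness

  pos∈supp : ∀ f → pos f ∈ supp (out f)
  pos∈supp f = sensitive⇒∈ {g = g} (dep (out f)) (sensitive f)

  covered : List Witness → Subset ℓ
  covered []       = ⊥
  covered (f ∷ fs) = supp (out f) ∪ covered fs

  ∩-covered-∷ : ∀ {A} f fs → A ∩ covered fs ⊆ A ∩ covered (f ∷ fs)
  ∩-covered-∷ f fs c∈ = let (c∈A , c∈cov) = x∈p∩q⁻ _ _ c∈ in x∈p∩q⁺ (c∈A , q⊆p∪q (supp (out f)) _ c∈cov)

  Disjoint : List Witness → Set
  Disjoint []       = ⊤
  Disjoint (f ∷ fs) = Empty (supp (out f) ∩ covered fs) × Disjoint fs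

  -- The t-th bit of y is written at the position of the t-th witness; the rest of
  -- its support keeps the witness' base point, and uncovered inputs are 0.
  embed : (fs : List Witness) → Bits (length fs) → Bits ℓ
  embed []       []       = replicate ℓ false
  embed (f ∷ fs) (y ∷ ys) = override (supp (out f)) (base f [ pos f ]≔ y) (embed fs ys)

  outputs : (fs : List Witness) → Fin (length fs) → Fin n
  outputs fs t = out (List.lookup fs t)

  response : (fs : List Witness) → Fin (length fs) → Bool → Bool
  response fs t b = lookup (g (base f [ pos f ]≔ b)) (out f)
    where f = List.lookup fs t

  supp⊆covered : ∀ fs t → supp (outputs fs t) ⊆ covered fs
  supp⊆covered (f ∷ fs) zero    c∈ = p⊆p∪q (covered fs) c∈
  supp⊆covered (f ∷ fs) (suc t) c∈ = q⊆p∪q (supp (out f)) (covered fs) (supp⊆covered fs t c∈)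

  ∣covered∣≤ : ∀ {d} → (∀ i → ∣ supp i ∣ ≤ d) → ∀ fs → ∣ covered fs ∣ ≤ d * length fs
  ∣covered∣≤ {d} supp≤d []       = ≤-reflexive (trans (∣⊥∣≡0 ℓ) (sym (*-zeroʳ d)))
  ∣covered∣≤ {d} supp≤d (f ∷ fs) = begin
    ∣ supp (out f) ∪ covered fs ∣       ≤⟨ ∣p∪q∣≤∣p∣+∣q∣ (supp (out f)) (covered fs) ⟩
    ∣ supp (out f) ∣ + ∣ covered fs ∣   ≤⟨ +-mono-≤ (supp≤d (out f)) (∣covered∣≤ supp≤d fs) ⟩
    d + d * length fs                   ≡⟨ *-suc d (length fs) ⟨
    d * suc (length fs)                 ∎
    where open ≤-Reasoning

  lookup-embed : ∀ fs → Disjoint fs → ∀ y t {c} → c ∈ supp (outputs fs t) →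
                 lookup (embed fs y) c ≡ lookup (base (List.lookup fs t) [ pos (List.lookup fs t) ]≔ lookup y t) c
  lookup-embed (f ∷ fs) _              (b ∷ y) zero    c∈ = lookup-override-∈ _ _ _ c∈
  lookup-embed (f ∷ fs) (disj , disjs) (b ∷ y) (suc t) c∈ =
    trans (lookup-override-∉ _ _ _ (λ c∈f → disj (_ , x∈p∩q⁺ (c∈f , supp⊆covered fs t c∈))))
          (lookup-embed fs disjs y t c∈)

  restrict-embed : ∀ fs → Disjoint fs → ∀ y t →
                   lookup (restrict (outputs fs) (g (embed fs y))) t ≡ response fs t (lookup y t)
  restrict-embed fs disj y t =
    trans (lookup∘tabulate _ t) (dep (outputs fs t) _ _ λ c c∈ → lookup-embed fs disj y t c∈)

  out-fresh : ∀ f fs → Empty (supp (out f) ∩ covered fs) → ∀ t → out f ≢ outputs fs t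
  out-fresh f fs disj t eq =
    disj (pos f′ , x∈p∩q⁺ (subst (λ i → pos f′ ∈ supp i) (sym eq) (pos∈supp f′) , supp⊆covered fs t (pos∈supp f′)))
    where f′ = List.lookup fs t

  outputs-injective : ∀ fs → Disjoint fs → Injective _≡_ _≡_ (outputs fs)
  outputs-injective (f ∷ fs) _            {zero}  {zero}   _  = refl
  outputs-injective (f ∷ fs) (disj , _)   {zero}  {suc t′} eq = contradiction eq (out-fresh f fs disj t′)
  outputs-injective (f ∷ fs) (disj , _)   {suc t} {zero}   eq = contradiction (sym eq) (out-fresh f fs disj t)
  outputs-injective (f ∷ fs) (_ , disjs)  {suc t} {suc t′} eq = cong suc (outputs-injective fs disjs eq)

  embed-agree : ∀ fs u v c → (∀ t → pos (List.lookup fs t) ≡ c → lookup u t ≡ lookup v t) →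
                lookup (embed fs u) c ≡ lookup (embed fs v) c
  embed-agree []       []      []      c _     = refl
  embed-agree (f ∷ fs) (a ∷ u) (b ∷ v) c agree with c ∈? supp (out f)
  ... | yes c∈ = trans (lookup-override-∈ _ _ _ c∈)
                   (trans (free-or-base (pos f ≟ᶠ c)) (sym (lookup-override-∈ _ _ _ c∈)))
    where
    free-or-base : Dec (pos f ≡ c) → lookup (base f [ pos f ]≔ a) c ≡ lookup (base f [ pos f ]≔ b) c
    free-or-base (yes pos≡c) = cong (λ x → lookup (base f [ pos f ]≔ x) c) (agree zero pos≡c)
    free-or-base (no  pos≢c) =
      trans (lookup∘update′ (pos≢c ∘ sym) (base f) a) (sym (lookup∘update′ (pos≢c ∘ sym) (base f) b))
  ... | no c∉ = trans (lookup-override-∉ _ _ _ c∉)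
                  (trans (embed-agree fs u v c (agree ∘ suc)) (sym (lookup-override-∉ _ _ _ c∉)))

  relevant : Fin n → (fs : List Witness) → Subset (length fs)
  relevant j []       = []
  relevant j (f ∷ fs) = does (pos f ∈? supp j) ∷ relevant j fs

  relevant-∈ : ∀ j fs t → pos (List.lookup fs t) ∈ supp j → t ∈ relevant j fs
  relevant-∈ j (f ∷ fs) zero    pos∈ with pos f ∈? supp j
  ... | yes _    = here
  ... | no  pos∉ = contradiction pos∈ pos∉
  relevant-∈ j (f ∷ fs) (suc t) pos∈ = there (relevant-∈ j fs t pos∈)

  ∣relevant∣≤ : ∀ j fs → Disjoint fs → ∣ relevant j fs ∣ ≤ ∣ supp j ∩ covered fs ∣
  ∣relevant∣≤ j []       _            = z≤n
  ∣relevant∣≤ j (f ∷ fs) (disj , disjs) with pos f ∈? supp j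
  ... | yes pos∈ = ≤-trans (s≤s (∣relevant∣≤ j fs disjs))
                           (p⊂q⇒∣p∣<∣q∣ (∩-covered-∷ {supp j} f fs , pos f , x∈p∩q⁺ (pos∈ , p⊆p∪q _ (pos∈supp f)) , pos∉))
    where
    pos∉ : pos f ∉ supp j ∩ covered fs
    pos∉ pos∈∩ = disj (pos f , x∈p∩q⁺ (pos∈supp f , proj₂ (x∈p∩q⁻ _ _ pos∈∩)))
  ... | no _ = ≤-trans (∣relevant∣≤ j fs disjs) (p⊆q⇒∣p∣≤∣q∣ (∩-covered-∷ {supp j} f fs))

  -- Output t reads off the t-th free bit bijectively, so the free bits are functions of
  -- the outputs, and output j sees only the free bits whose position lies in supp j.
  embed-NOBF : ∀ {d} → (∀ i → ∣ supp i ∣ ≤ d) → ∀ fs → Disjoint fs → NOBF d (length fs) (g ∘ embed fs)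
  embed-NOBF {d} supp≤d fs disj = outputs fs , outputs-injective fs disj , uniform , λ j _ → determined j
    where
    observed : Bits (length fs) → Bits (length fs)
    observed u = restrict (outputs fs) (g (embed fs u))
    uniform : ∀ y → count observed y * 2 ^ length fs ≡ 2 ^ length fs
    uniform y = trans (cong (_* 2 ^ length fs) (count-bitwise-bijection observed (response fs)
                         (λ t → sensitive (List.lookup fs t)) (restrict-embed fs disj) y))
                      (*-identityˡ _)
    free-bit : ∀ u v t → lookup (observed u) t ≡ lookup (observed v) t → lookup u t ≡ lookup v t
    free-bit u v t eq = bool-injective (response fs t) (sensitive (List.lookup fs t))
      (trans (sym (restrict-embed fs disj u t)) (trans eq (restrict-embed fs disj v t)))
    determined : ∀ j → ∃[ T ] (∣ T ∣ ≤ d × (∀ u v → (∀ t → t ∈ T → lookup (observed u) t ≡ lookup (observed v) t) →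
                                                 lookup (g (embed fs u)) j ≡ lookup (g (embed fs v)) j))
    determined j =
      relevant j fs , ≤-trans (∣relevant∣≤ j fs disj) (≤-trans (∣p∩q∣≤∣p∣ (supp j) (covered fs)) (supp≤d j)) ,
      λ u v agree → dep j _ _ λ c c∈ → embed-agree fs u v c λ t pos≡c →
        free-bit u v t (agree t (relevant-∈ j fs t (subst (_∈ supp j) (sym pos≡c) c∈)))

  embed-subsource : ∀ {d k} → (∀ i → ∣ supp i ∣ ≤ d) → ∀ fs → Disjoint fs → k ≤ d * d * length fs →
                    NOBFSubsource d k g
  embed-subsource supp≤d fs disj k≤ =
    length fs , g ∘ embed fs , length fs , embed-NOBF supp≤d fs disj , k≤ , λ y → embed fs y , refl

  Saturated : List Witness → Fin n → Set
  Saturated fs i = DependsOnly g i ⊥ ⊎ Nonempty (supp i ∩ covered fs)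

  saturated-∷ : ∀ f fs {i} → Saturated fs i → Saturated (f ∷ fs) i
  saturated-∷ f fs (inj₁ const)     = inj₁ const
  saturated-∷ f fs (inj₂ (c , c∈)) = inj₂ (c , ∩-covered-∷ f fs c∈)

  maximal : (is : List (Fin n)) → ∃[ fs ] (Disjoint fs × All (Saturated fs) is)
  maximal []       = [] , tt , []
  maximal (i ∷ is) with maximal is
  ... | fs , disj , sat with flipInvariant-or-sensitive g i
  ...   | inj₁ inv = fs , disj , inj₁ (flipInvariant⇒dependsOnly-⊥ g i inv) ∷ sat
  ...   | inj₂ (w , p , sens) with nonempty? (supp i ∩ covered fs)
  ...     | yes meets  = fs , disj , inj₂ meets ∷ sat
  ...     | no  misses = f ∷ fs , (misses , disj) ,
                         inj₂ (p , x∈p∩q⁺ (pos∈supp f , p⊆p∪q _ (pos∈supp f))) ∷ All.map (saturated-∷ f fs) sat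
    where f = witness i w p sens

  clear-local : ∀ {e} → (∀ i → ∣ supp i ∣ ≤ suc e) → ∀ fs → (∀ i → Saturated fs i) →
                Local e (g ∘ clear (covered fs))
  clear-local {e} supp≤ fs sat i with sat i
  ... | inj₁ const = ⊥ ─ covered fs , ∣⊥─U∣≤e , dependsOnly-clear (covered fs) g const
    where
    ∣⊥─U∣≤e : ∣ ⊥ ─ covered fs ∣ ≤ e
    ∣⊥─U∣≤e = ≤-trans (≤-trans (∣p─q∣≤∣p∣ ⊥ (covered fs)) (≤-reflexive (∣⊥∣≡0 ℓ))) z≤n
  ... | inj₂ meets = supp i ─ covered fs , ≤-pred (≤-trans (p∩q≢∅⇒∣p─q∣<∣p∣ _ _ meets) (supp≤ i)) ,
                     dependsOnly-clear (covered fs) g (dep i)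

-- The induction on locality

NOBF-mono : ∀ {ℓ n d d′ m} {h : Bits ℓ → Bits n} → d ≤ d′ → NOBF d m h → NOBF d′ m h
NOBF-mono d≤d′ (σ , σ-inj , uniform , determined) =
  σ , σ-inj , uniform , λ j j∉σ → let (T , ∣T∣≤d , dep) = determined j j∉σ in T , ≤-trans ∣T∣≤d d≤d′ , dep

-- With E = e + 1: E·k ≤ E(E r + e² m) < k + E e² m, so e k < e (E e m) and k < E e m ≤ E² m.
square-bound : ∀ e k s r m → s ≤ suc e * r → suc e * suc e * r < k → k ∸ s ≤ e * e * m → k ≤ suc e * suc e * m
square-bound e k s r m s≤ k> k∸s≤ = ≤-trans (<⇒≤ k<Eem) (*-monoˡ-≤ m (*-monoʳ-≤ E (n≤1+n e)))
  where
  E = suc e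
  k≤ : k ≤ E * r + e * e * m
  k≤ = ≤-trans (m≤n+m∸n k s) (+-mono-≤ s≤ k∸s≤)
  regroup : ∀ e m → e * (suc e * e * m) ≡ suc e * (e * e * m)
  regroup = solve-∀
  Ek< : E * E * r + suc (e * k) ≤ E * E * r + e * (E * e * m)
  Ek< = begin
    E * E * r + suc (e * k)        ≡⟨ +-suc _ _ ⟩
    suc (E * E * r) + e * k        ≤⟨ +-monoˡ-≤ (e * k) k> ⟩
    E * k                          ≤⟨ *-monoʳ-≤ E k≤ ⟩
    E * (E * r + e * e * m)        ≡⟨ *-distribˡ-+ E (E * r) _ ⟩
    E * (E * r) + E * (e * e * m)  ≡⟨ cong₂ _+_ (*-assoc E E r) (regroup e m) ⟨
    E * E * r + e * (E * e * m)    ∎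
    where open ≤-Reasoning
  k<Eem : k < E * e * m
  k<Eem = *-cancelˡ-< e k (E * e * m) (+-cancelˡ-≤ (E * E * r) _ _ Ek<)

local-0⇒constant : ∀ {ℓ n} (g : Bits ℓ → Bits n) → Local 0 g → ∀ u v → g u ≡ g v
local-0⇒constant g loc u v = lookup-ext _ _ λ i →
  let (T , ∣T∣≤0 , dep) = loc i in dep u v λ c c∈T → contradiction (<-≤-trans (x∈p⇒∣p-x∣<∣p∣ c∈T) ∣T∣≤0) n≮0

constant⇒minEntropy≡0 : ∀ {ℓ n k} (g : Bits ℓ → Bits n) → (∀ u v → g u ≡ g v) → MinEntropyAtLeast k g → k ≡ 0
constant⇒minEntropy≡0 {ℓ} {k = k} g const me = 2^k≤1⇒k≡0 k (*-cancelˡ-≤ (2 ^ ℓ) {{m^n≢0 2 ℓ}} (begin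
  2 ^ ℓ * 2 ^ k       ≡⟨ cong (_* 2 ^ k) (count-all g x (λ u → const u u₀)) ⟨
  count g x * 2 ^ k   ≤⟨ me x ⟩
  2 ^ ℓ               ≡⟨ *-identityʳ (2 ^ ℓ) ⟨
  2 ^ ℓ * 1           ∎))
  where
  open ≤-Reasoning
  u₀ = replicate ℓ false
  x = g u₀

module Step (e : ℕ) {ℓ n} (g : Bits ℓ → Bits n) (loc : Local (suc e) g) where

  supp : Fin n → Subset ℓ
  supp i = proj₁ (loc i)

  supp≤ : ∀ i → ∣ supp i ∣ ≤ suc e
  supp≤ i = proj₁ (proj₂ (loc i))

  open Family g supp (λ i → proj₂ (proj₂ (loc i)))

  fs : List Witness
  fs = proj₁ (maximal (allFin n))

  disjoint : Disjoint fs
  disjoint = proj₁ (proj₂ (maximal (allFin n)))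

  saturated : ∀ i → Saturated fs i
  saturated i = All.lookup (proj₂ (proj₂ (maximal (allFin n)))) (∈-allFin i)

  ∣covered∣≤k : ∀ {k} → suc e * suc e * length fs < k → ∣ covered fs ∣ ≤ k
  ∣covered∣≤k k> = ≤-trans (∣covered∣≤ supp≤ fs) (≤-trans (*-monoˡ-≤ (length fs) (m≤m*n (suc e) (suc e))) (<⇒≤ k>))

  lift-subsource : ∀ {k} → suc e * suc e * length fs < k →
                   NOBFSubsource e (k ∸ ∣ covered fs ∣) (g ∘ clear (covered fs)) → NOBFSubsource (suc e) k g
  lift-subsource {k} k> (ℓ′ , h , m , nobf , k′≤ , sub) =
    ℓ′ , h , m , NOBF-mono {h = h} (n≤1+n e) nobf ,
    square-bound e k _ (length fs) m (∣covered∣≤ supp≤ fs) k> k′≤ ,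
    λ u′ → clear (covered fs) (proj₁ (sub u′)) , proj₂ (sub u′)

  step : ∀ k → MinEntropyAtLeast k g →
         (∀ k′ (g′ : Bits ℓ → Bits n) → Local e g′ → MinEntropyAtLeast k′ g′ → NOBFSubsource e k′ g′) →
         NOBFSubsource (suc e) k g
  step k me ih with k ≤? suc e * suc e * length fs
  ... | yes k≤ = embed-subsource supp≤ fs disjoint k≤
  ... | no  k≰ = lift-subsource (≰⇒> k≰)
    (ih _ _ (clear-local supp≤ fs saturated) (minEntropy-clear (covered fs) g (∣covered∣≤k (≰⇒> k≰)) me))

local⇒NOBFSubsource : ∀ d {ℓ n} (g : Bits ℓ → Bits n) k → Local d g → MinEntropyAtLeast k g → NOBFSubsource d k g
local⇒NOBFSubsource zero g k loc me =
  embed-subsource (λ i → proj₁ (proj₂ (loc i))) [] tt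
    (≤-reflexive (constant⇒minEntropy≡0 g (local-0⇒constant g loc) me))
  where open Family g (λ i → proj₁ (loc i)) (λ i → proj₂ (proj₂ (loc i)))
local⇒NOBFSubsource (suc e) g k loc me =
  Step.step e g loc k me (λ k′ g′ → local⇒NOBFSubsource e g′ k′)

mainTheorem9 : ∃[ p ] ∃[ q ] (0 < p × 0 < q ×
    (∀ (n k d ℓ : ℕ) (g : Bits ℓ → Bits n) → Local d g → MinEntropyAtLeast k g →
    ∃[ ℓ' ] Σ (Bits ℓ' → Bits n) λ h → ∃[ m ] (NOBF d m h × p * k ≤ q * (d * d) * m × SupportSubset h g)))
mainTheorem9 = 1 , 1 , z<s , z<s , λ n k d ℓ g loc me →
  let (ℓ′ , h , m , nobf , k≤ , sub) = local⇒NOBFSubsource d g k loc me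
  in  ℓ′ , h , m , nobf , subst₂ _≤_ (sym (*-identityˡ k)) (cong (_* m) (sym (*-identityˡ (d * d)))) k≤ , sub
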